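{- Let $T$ be the Tietze graph, with vertex set $\{1,\dots,12\}$ and edge set $\{1,2\},\{2,3\},\{3,4\},\{4,5\},\{5,6\},\{6,7\},\{7,8\},\{8,9\},\{1,9\},\{1,10\},\{4,11\},\{7,12\},\{3,8\},\{2,6\},\{5,9\},\{10,11\},\{11,12\},\{10,12\}$. There exist $T$ designs of order $28$, $37$, $64$, $73$ and $100$.
   Context: All graphs are simple. For a graph $G$, a $G$ design of order $n$ is a partition of the edge set of the complete graph $K_n$ into edge sets of subgraphs each isomorphic to $G$. -}

module Defs where

open import Data.Nat using (ℕ; zero; suc; _+_)
open import Data.Fin using (Fin; zero; suc; _≟_; #_)
open import Data.Bool using (Bool; true; false; _∧_; _∨_)
open import Data.List using (List; []; _∷_; map)
open import Data.Nat.ListAction using (sum)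
open import Data.List.Relation.Unary.All using (All)
open import Data.Product using (_×_; _,_; Σ-syntax)
open import Function.Definitions using (Injective)
open import Relation.Binary.PropositionalEquality using (_≡_; _≢_)
open import Relation.Nullary.Decidable using (⌊_⌋)

-- A simple graph on vertex set Fin v, given by its list of edges
-- (each unordered edge {a,b} listed once as a pair (a , b), a ≠ b).
EdgeList : ℕ → Set
EdgeList v = List (Fin v × Fin v)

hits : ∀ {v n} → (Fin v → Fin n) → Fin n → Fin n → Fin v × Fin v → ℕ
hits f x y (a , b) with ⌊ f a ≟ x ⌋ ∧ ⌊ f b ≟ y ⌋ ∨ ⌊ f a ≟ y ⌋ ∧ ⌊ f b ≟ x ⌋
... | true  = 1
... | false = 0

inCopy : ∀ {v n} → EdgeList v → (Fin v → Fin n) → Fin n → Fin n → ℕ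
inCopy E f x y = sum (map (hits f x y) E)

multiplicity : ∀ {v n} → EdgeList v → List (Fin v → Fin n) → Fin n → Fin n → ℕ
multiplicity E B x y = sum (map (λ f → inCopy E f x y) B)

-- A G design of order n: a collection of subgraphs of K_n, each isomorphic
-- to G (given as the image of G under an injective vertex map), whose edge
-- sets partition the edge set of K_n, i.e. every edge {x,y} of K_n lies in
-- exactly one of them.
IsDesign : ∀ {v} → EdgeList v → (n : ℕ) → List (Fin v → Fin n) → Set
IsDesign E n B =
  All Injective′ B × (∀ (x y : Fin n) → x ≢ y → multiplicity E B x y ≡ 1)
  where
  Injective′ : (Fin _ → Fin n) → Set
  Injective′ f = Injective _≡_ _≡_ f

HasDesign : ∀ {v} → EdgeList v → ℕ → Set
HasDesign {v} E n = Σ[ B ∈ List (Fin v → Fin n) ] IsDesign E n B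

-- The Tietze graph; vertex i ∈ {1,…,12} of the paper is  # (i - 1).
tietze : EdgeList 12
tietze =
  (# 0 , # 1) ∷ (# 1 , # 2) ∷ (# 2 , # 3) ∷ (# 3 , # 4) ∷ (# 4 , # 5) ∷
  (# 5 , # 6) ∷ (# 6 , # 7) ∷ (# 7 , # 8) ∷ (# 0 , # 8) ∷ (# 0 , # 9) ∷
  (# 3 , # 10) ∷ (# 6 , # 11) ∷ (# 2 , # 7) ∷ (# 1 , # 5) ∷ (# 4 , # 8) ∷
  (# 9 , # 10) ∷ (# 10 , # 11) ∷ (# 9 , # 11) ∷ []

module Submission where

-- Each design is obtained, as in the paper, by developing a few base blocks under ℤ_m, acting
-- on ℤ_(k/m) × ℤ_m by translation in the second coordinate and fixing n − k points at
-- infinity. Correctness is checked by computation: encode an edge {x , y} of K_n with x < y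
-- as y + x n; then injective copies of G form a design exactly when the codes of all their
-- edges are a permutation of the codes of the edges of K_n, and sorting both lists decides
-- this.

open import Defs
open import Data.Bool using (true; if_then_else_)
open import Data.Empty using (⊥-elim)
open import Data.Fin using (Fin; toℕ; _≟_; _<_)
open import Data.Fin.Properties using (toℕ-injective; toℕ<n; _≤?_; ≤-antisym; ≤∧≢⇒<; all?)
open import Data.List using (List; []; _∷_; _++_; map; concatMap; filter; upTo; downFrom)
open import Data.List.Membership.Propositional using (_∈_; _∉_)
open import Data.List.Membership.Propositional.Properties using (∈-filter⁺; ∈-downFrom⁺)
open import Data.List.Relation.Binary.Permutation.Propositional
  using (_↭_; ↭-sym; ↭-trans; ↭-reflexive)
open import Data.List.Relation.Binary.Permutation.Propositional.Properties using (map⁺)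
open import Data.List.Relation.Unary.All using (All)
open import Data.List.Relation.Unary.Any using (here; there)
open import Data.List.Relation.Unary.Unique.Propositional using (Unique; _∷_)
import Data.List.Relation.Unary.Unique.Propositional.Properties as Unique
import Data.List.Relation.Unary.All as All
import Data.List.Sort.MergeSort.Base as MergeSortBase
import Data.List.Sort.MergeSort.Properties as MergeSortProperties
import Data.List.Properties as List
open import Data.Nat as ℕ using (ℕ; NonZero; _+_; _*_; _/_; _%_; _<ᵇ_)
open import Data.Nat.DivMod
  using (_mod_; [m+kn]%n≡m%n; m<n⇒m%n≡m; m<n⇒m/n≡0; m*n/n≡m; +-distrib-/-∣ʳ)
open import Data.Nat.Divisibility using (n∣m*n)
open import Data.Nat.ListAction using (sum)
open import Data.Nat.ListAction.Properties using (sum-++; sum-↭)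
open import Data.Nat.Properties as ℕ using (≤-decTotalOrder)
open import Data.Product using (_×_; _,_; proj₁; proj₂; swap)
open import Data.Sum using (_⊎_; inj₁; inj₂; [_,_])
open import Data.Vec as Vec using (Vec; lookup; []; _∷_)
open import Function using (_∘_)
open import Function.Definitions using (Injective)
open import Relation.Binary.PropositionalEquality hiding ([_])
open import Relation.Nullary using (Dec; yes; no; ¬_; does; map′)
open import Relation.Nullary.Decidable using (_→-dec_)

open MergeSortBase ≤-decTotalOrder using (sort)
open MergeSortProperties ≤-decTotalOrder using (sort-↭)

δ : ℕ → ℕ → ℕ
δ c d with c ℕ.≟ d
... | yes _ = 1
... | no _  = 0

δ-refl : ∀ c → δ c c ≡ 1
δ-refl c with c ℕ.≟ c
... | yes _  = refl
... | no c≢c = ⊥-elim (c≢c refl)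

δ-≢ : ∀ {c d} → c ≢ d → δ c d ≡ 0
δ-≢ {c} {d} c≢d with c ℕ.≟ d
... | yes c≡d = ⊥-elim (c≢d c≡d)
... | no _    = refl

occurrences : ℕ → List ℕ → ℕ
occurrences c xs = sum (map (δ c) xs)

occurrences-++ : ∀ c xs ys → occurrences c (xs ++ ys) ≡ occurrences c xs + occurrences c ys
occurrences-++ c xs ys =
  trans (cong sum (List.map-++ (δ c) xs ys)) (sum-++ (map (δ c) xs) (map (δ c) ys))

occurrences-↭ : ∀ c {xs ys} → xs ↭ ys → occurrences c xs ≡ occurrences c ys
occurrences-↭ c xs↭ys = sum-↭ (map⁺ (δ c) xs↭ys)

occurrences-∉ : ∀ {c xs} → c ∉ xs → occurrences c xs ≡ 0
occurrences-∉ {xs = []}     c∉xs = refl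
occurrences-∉ {xs = x ∷ xs} c∉xs =
  cong₂ _+_ (δ-≢ (c∉xs ∘ here)) (occurrences-∉ (c∉xs ∘ there))

occurrences-unique : ∀ {c xs} → Unique xs → c ∈ xs → occurrences c xs ≡ 1
occurrences-unique (x∉xs ∷ _) (here refl) =
  cong₂ _+_ (δ-refl _) (occurrences-∉ (λ x∈xs → All.lookup x∉xs x∈xs refl))
occurrences-unique (x∉xs ∷ xs!) (there c∈xs) =
  cong₂ _+_ (δ-≢ λ { refl → All.lookup x∉xs c∈xs refl }) (occurrences-unique xs! c∈xs)

module EdgeCode (n : ℕ) .{{_ : NonZero n}} where

  pair : Fin n → Fin n → ℕ
  pair a b = toℕ b + toℕ a * n

  pair-% : ∀ a b → pair a b % n ≡ toℕ b
  pair-% a b = trans ([m+kn]%n≡m%n (toℕ b) (toℕ a) n) (m<n⇒m%n≡m (toℕ<n b))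

  pair-/ : ∀ a b → pair a b / n ≡ toℕ a
  pair-/ a b = begin
    (toℕ b + toℕ a * n) / n     ≡⟨ +-distrib-/-∣ʳ (toℕ b) (n∣m*n (toℕ a)) ⟩
    toℕ b / n + toℕ a * n / n   ≡⟨ cong₂ _+_ (m<n⇒m/n≡0 (toℕ<n b)) (m*n/n≡m (toℕ a) n) ⟩
    toℕ a                       ∎
    where open ≡-Reasoning

  pair-injective : ∀ {a b c d} → pair a b ≡ pair c d → a ≡ c × b ≡ d
  pair-injective {a} {b} {c} {d} eq =
      toℕ-injective (trans (sym (pair-/ a b)) (trans (cong (_/ n) eq) (pair-/ c d)))
    , toℕ-injective (trans (sym (pair-% a b)) (trans (cong (_% n) eq) (pair-% c d)))

  pair-< : ∀ a b → pair a b ℕ.< n * n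
  pair-< a b = begin-strict
    toℕ b + toℕ a * n  <⟨ ℕ.+-monoˡ-< (toℕ a * n) (toℕ<n b) ⟩
    n + toℕ a * n      ≤⟨ ℕ.*-monoˡ-≤ n (toℕ<n a) ⟩
    n * n              ∎
    where open ℕ.≤-Reasoning

  edgeCode : Fin n → Fin n → ℕ
  edgeCode x y with x ≤? y
  ... | yes _ = pair x y
  ... | no _  = pair y x

  edgeCode-comm : ∀ x y → edgeCode x y ≡ edgeCode y x
  edgeCode-comm x y with x ≤? y | y ≤? x
  ... | yes x≤y | yes y≤x = cong₂ pair (≤-antisym x≤y y≤x) (≤-antisym y≤x x≤y)
  ... | yes _   | no _    = refl
  ... | no _    | yes _   = refl
  ... | no x≰y  | no y≰x  = ⊥-elim (x≰y (ℕ.<⇒≤ (ℕ.≰⇒> y≰x)))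

  edgeCode-injective : ∀ {p q x y} → edgeCode p q ≡ edgeCode x y →
                       (p ≡ x × q ≡ y) ⊎ (p ≡ y × q ≡ x)
  edgeCode-injective {p} {q} {x} {y} eq with p ≤? q | x ≤? y
  ... | yes _ | yes _ = inj₁ (pair-injective eq)
  ... | yes _ | no _  = inj₂ (pair-injective eq)
  ... | no _  | yes _ = inj₂ (swap (pair-injective eq))
  ... | no _  | no _  = inj₁ (swap (pair-injective eq))

  Ascending : ℕ → Set
  Ascending c = c / n ℕ.< c % n

  ascending? : ∀ c → Dec (Ascending c)
  ascending? c = c / n ℕ.<? c % n

  pair-ascending : ∀ {a b} → a < b → Ascending (pair a b)
  pair-ascending {a} {b} = subst₂ ℕ._<_ (sym (pair-/ a b)) (sym (pair-% a b))

  edgeCode-ascending : ∀ {x y} → x ≢ y → Ascending (edgeCode x y)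
  edgeCode-ascending {x} {y} x≢y with x ≤? y
  ... | yes x≤y = pair-ascending (≤∧≢⇒< x≤y x≢y)
  ... | no x≰y  = pair-ascending (ℕ.≰⇒> x≰y)

  edgeCode-< : ∀ x y → edgeCode x y ℕ.< n * n
  edgeCode-< x y with x ≤? y
  ... | yes _ = pair-< x y
  ... | no _  = pair-< y x

  -- c < n * n is the code pair (c / n) (c % n), so these are the codes pair a b with a < b.
  -- (downFrom rather than upTo: normalising upTo N takes time quadratic in N.)
  edgeCodes : List ℕ
  edgeCodes = filter ascending? (downFrom (n * n))

  occurrences-edgeCodes : ∀ {x y} → x ≢ y → occurrences (edgeCode x y) edgeCodes ≡ 1
  occurrences-edgeCodes {x} {y} x≢y = occurrences-unique
    (Unique.filter⁺ ascending? (Unique.downFrom⁺ (n * n)))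
    (∈-filter⁺ ascending? (∈-downFrom⁺ (edgeCode-< x y)) (edgeCode-ascending x≢y))

  δ-edgeCode-≢ : ∀ x y p q → ¬ (p ≡ x × q ≡ y) → ¬ (p ≡ y × q ≡ x) →
                 δ (edgeCode x y) (edgeCode p q) ≡ 0
  δ-edgeCode-≢ _ _ _ _ ¬straight ¬crossed =
    δ-≢ λ eq → [ ¬straight , ¬crossed ] (edgeCode-injective (sym eq))

  hits≡δ : ∀ {v} (f : Fin v → Fin n) {x y} → x ≢ y → ∀ e →
           hits f x y e ≡ δ (edgeCode x y) (edgeCode (f (proj₁ e)) (f (proj₂ e)))
  hits≡δ f {x} {y} x≢y (a , b) with f a ≟ x | f b ≟ y | f a ≟ y | f b ≟ x
  ... | yes refl | yes refl | _        | _        = sym (δ-refl _)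
  ... | yes refl | no _     | yes x≡y  | _        = ⊥-elim (x≢y x≡y)
  ... | yes _    | no fb≢y  | no fa≢y  | _        =
    sym (δ-edgeCode-≢ x y (f a) (f b) (fb≢y ∘ proj₂) (fa≢y ∘ proj₁))
  ... | no _     | _        | yes refl | yes refl =
    sym (trans (cong (δ _) (edgeCode-comm y x)) (δ-refl _))
  ... | no fa≢x  | _        | yes _    | no fb≢x  =
    sym (δ-edgeCode-≢ x y (f a) (f b) (fa≢x ∘ proj₁) (fb≢x ∘ proj₂))
  ... | no fa≢x  | _        | no fa≢y  | _        =
    sym (δ-edgeCode-≢ x y (f a) (f b) (fa≢x ∘ proj₁) (fa≢y ∘ proj₁))

  copyCodes : ∀ {v} → EdgeList v → (Fin v → Fin n) → List ℕ
  copyCodes E f = map (λ e → edgeCode (f (proj₁ e)) (f (proj₂ e))) E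

  edgeCodesOf : ∀ {v} → EdgeList v → List (Fin v → Fin n) → List ℕ
  edgeCodesOf E = concatMap (copyCodes E)

  inCopy≡occurrences : ∀ {v} (E : EdgeList v) f {x y} → x ≢ y →
                       inCopy E f x y ≡ occurrences (edgeCode x y) (copyCodes E f)
  inCopy≡occurrences []      f x≢y = refl
  inCopy≡occurrences (e ∷ E) f x≢y =
    cong₂ _+_ (hits≡δ f x≢y e) (inCopy≡occurrences E f x≢y)

  multiplicity≡occurrences : ∀ {v} (E : EdgeList v) B {x y} → x ≢ y →
                             multiplicity E B x y ≡ occurrences (edgeCode x y) (edgeCodesOf E B)
  multiplicity≡occurrences E []      x≢y = refl
  multiplicity≡occurrences E (f ∷ B) {x} {y} x≢y = begin
    inCopy E f x y + multiplicity E B x y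
      ≡⟨ cong₂ _+_ (inCopy≡occurrences E f x≢y) (multiplicity≡occurrences E B x≢y) ⟩
    occurrences c (copyCodes E f) + occurrences c (edgeCodesOf E B)
      ≡⟨ occurrences-++ c (copyCodes E f) (edgeCodesOf E B) ⟨
    occurrences c (edgeCodesOf E (f ∷ B))
      ∎
    where
    c : ℕ
    c = edgeCode x y
    open ≡-Reasoning

  isDesign-↭ : ∀ {v} (E : EdgeList v) {B} → All (Injective _≡_ _≡_) B →
               edgeCodesOf E B ↭ edgeCodes → IsDesign E n B
  isDesign-↭ E {B} injective codes↭ = injective , λ x y x≢y → begin
    multiplicity E B x y                        ≡⟨ multiplicity≡occurrences E B x≢y ⟩
    occurrences (edgeCode x y) (edgeCodesOf E B) ≡⟨ occurrences-↭ (edgeCode x y) codes↭ ⟩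
    occurrences (edgeCode x y) edgeCodes         ≡⟨ occurrences-edgeCodes x≢y ⟩
    1                                            ∎
    where open ≡-Reasoning

↭-by-sort : ∀ {xs ys} → sort xs ≡ sort ys → xs ↭ ys
↭-by-sort {xs} {ys} sorted =
  ↭-trans (↭-sym (sort-↭ xs)) (↭-trans (↭-reflexive sorted) (sort-↭ ys))

injective? : ∀ {m n} (f : Fin m → Fin n) → Dec (Injective _≡_ _≡_ f)
injective? f = map′ (λ inj {i} {j} → inj i j) (λ inj i j → inj {i} {j})
  (all? λ i → all? λ j → (f i ≟ f j) →-dec (i ≟ j))

block : ∀ {v} (n : ℕ) .{{_ : NonZero n}} → Vec ℕ v → Fin v → Fin n
block n xs i = lookup xs i mod n

from-does : ∀ {A : Set} (a? : Dec A) → does a? ≡ true → A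
from-does (yes a) _ = a

-- The injectivity check is phrased with does rather than True, which normalises far more slowly.
hasDesign-byComputation :
  ∀ {v} (E : EdgeList v) (n : ℕ) .{{_ : NonZero n}} (blocks : List (Vec ℕ v)) →
  let open EdgeCode n; copies = map (block n) blocks in
  does (All.all? injective? copies) ≡ true →
  sort (edgeCodesOf E copies) ≡ sort edgeCodes →
  HasDesign E n
hasDesign-byComputation {v} E n blocks injective sorted =
  copies , isDesign-↭ E (from-does (All.all? injective? copies) injective) (↭-by-sort sorted)
  where
  open EdgeCode n
  copies : List (Fin v → Fin n)
  copies = map (block n) blocks

-- Points p < k stand for the pairs (p / m , p % m) of ℤ_(k/m) × ℤ_m, on which t acts by
-- translation in the second coordinate; points p ≥ k are fixed.
translate : (m : ℕ) .{{_ : NonZero m}} → ℕ → ℕ → ℕ → ℕ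
translate m k t p = if p <ᵇ k then p / m * m + (p % m + t) % m else p

orbits : ∀ {v} (m : ℕ) .{{_ : NonZero m}} → ℕ → ℕ → List (Vec ℕ v) → List (Vec ℕ v)
orbits m k c bases = concatMap (λ t → map (Vec.map (translate m k t)) bases) (upTo c)

base₂₈ : List (Vec ℕ 12)
base₂₈ =
    (21 ∷ 6 ∷ 1 ∷ 4 ∷ 23 ∷ 13 ∷ 24 ∷ 19 ∷ 20 ∷ 7 ∷ 17 ∷ 9 ∷ [])
  ∷ (0 ∷ 14 ∷ 12 ∷ 1 ∷ 24 ∷ 21 ∷ 26 ∷ 13 ∷ 25 ∷ 9 ∷ 20 ∷ 15 ∷ [])
  ∷ (14 ∷ 4 ∷ 5 ∷ 22 ∷ 13 ∷ 9 ∷ 1 ∷ 11 ∷ 18 ∷ 23 ∷ 2 ∷ 17 ∷ [])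
  ∷ []

base₃₇ : List (Vec ℕ 12)
base₃₇ =
    (0 ∷ 2 ∷ 9 ∷ 32 ∷ 6 ∷ 31 ∷ 25 ∷ 8 ∷ 27 ∷ 13 ∷ 17 ∷ 22 ∷ [])
  ∷ []

base₆₄ : List (Vec ℕ 12)
base₆₄ =
    (33 ∷ 57 ∷ 40 ∷ 20 ∷ 59 ∷ 61 ∷ 35 ∷ 46 ∷ 62 ∷ 22 ∷ 16 ∷ 38 ∷ [])
  ∷ (22 ∷ 63 ∷ 13 ∷ 36 ∷ 45 ∷ 54 ∷ 26 ∷ 28 ∷ 35 ∷ 42 ∷ 11 ∷ 27 ∷ [])
  ∷ (12 ∷ 21 ∷ 27 ∷ 15 ∷ 48 ∷ 58 ∷ 5 ∷ 62 ∷ 23 ∷ 2 ∷ 3 ∷ 8 ∷ [])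
  ∷ (45 ∷ 19 ∷ 32 ∷ 23 ∷ 4 ∷ 42 ∷ 57 ∷ 15 ∷ 22 ∷ 33 ∷ 9 ∷ 2 ∷ [])
  ∷ (54 ∷ 46 ∷ 1 ∷ 27 ∷ 48 ∷ 0 ∷ 43 ∷ 14 ∷ 35 ∷ 53 ∷ 31 ∷ 2 ∷ [])
  ∷ []

-- This copy is fixed by translation by 7, so its orbit has only 7 members.
short₆₄ : List (Vec ℕ 12)
short₆₄ =
    (10 ∷ 50 ∷ 15 ∷ 17 ∷ 57 ∷ 1 ∷ 3 ∷ 43 ∷ 8 ∷ 47 ∷ 54 ∷ 61 ∷ [])
  ∷ []

base₇₃ : List (Vec ℕ 12)
base₇₃ =
    (0 ∷ 48 ∷ 42 ∷ 61 ∷ 63 ∷ 5 ∷ 62 ∷ 30 ∷ 53 ∷ 69 ∷ 25 ∷ 34 ∷ [])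
  ∷ (0 ∷ 46 ∷ 41 ∷ 65 ∷ 18 ∷ 57 ∷ 71 ∷ 20 ∷ 60 ∷ 55 ∷ 62 ∷ 54 ∷ [])
  ∷ []

base₁₀₀ : List (Vec ℕ 12)
base₁₀₀ =
    (21 ∷ 7 ∷ 29 ∷ 16 ∷ 17 ∷ 68 ∷ 84 ∷ 45 ∷ 93 ∷ 26 ∷ 79 ∷ 2 ∷ [])
  ∷ (62 ∷ 76 ∷ 97 ∷ 11 ∷ 64 ∷ 59 ∷ 96 ∷ 13 ∷ 83 ∷ 66 ∷ 29 ∷ 74 ∷ [])
  ∷ (6 ∷ 24 ∷ 57 ∷ 36 ∷ 47 ∷ 66 ∷ 77 ∷ 30 ∷ 53 ∷ 11 ∷ 90 ∷ 52 ∷ [])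
  ∷ (0 ∷ 26 ∷ 81 ∷ 58 ∷ 84 ∷ 27 ∷ 30 ∷ 97 ∷ 34 ∷ 74 ∷ 20 ∷ 60 ∷ [])
  ∷ (51 ∷ 12 ∷ 80 ∷ 74 ∷ 19 ∷ 92 ∷ 98 ∷ 85 ∷ 34 ∷ 8 ∷ 18 ∷ 39 ∷ [])
  ∷ (78 ∷ 32 ∷ 40 ∷ 55 ∷ 90 ∷ 60 ∷ 67 ∷ 73 ∷ 34 ∷ 22 ∷ 56 ∷ 49 ∷ [])
  ∷ (1 ∷ 72 ∷ 37 ∷ 21 ∷ 56 ∷ 99 ∷ 97 ∷ 73 ∷ 71 ∷ 88 ∷ 23 ∷ 89 ∷ [])
  ∷ (95 ∷ 98 ∷ 69 ∷ 78 ∷ 50 ∷ 28 ∷ 48 ∷ 72 ∷ 46 ∷ 85 ∷ 45 ∷ 33 ∷ [])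
  ∷ (48 ∷ 25 ∷ 18 ∷ 96 ∷ 35 ∷ 2 ∷ 27 ∷ 68 ∷ 6 ∷ 73 ∷ 64 ∷ 16 ∷ [])
  ∷ (37 ∷ 30 ∷ 98 ∷ 80 ∷ 20 ∷ 16 ∷ 24 ∷ 36 ∷ 17 ∷ 31 ∷ 65 ∷ 27 ∷ [])
  ∷ (0 ∷ 9 ∷ 76 ∷ 5 ∷ 94 ∷ 83 ∷ 42 ∷ 7 ∷ 19 ∷ 69 ∷ 57 ∷ 77 ∷ [])
  ∷ []

lemma1 : HasDesign tietze 28 × HasDesign tietze 37 × HasDesign tietze 64
    × HasDesign tietze 73 × HasDesign tietze 100
lemma1 =
    hasDesign-byComputation tietze 28  (orbits 7 28 7 base₂₈) refl refl
  , hasDesign-byComputation tietze 37  (orbits 37 37 37 base₃₇) refl refl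
  , hasDesign-byComputation tietze 64  (orbits 21 63 21 base₆₄ ++ orbits 21 63 7 short₆₄) refl refl
  , hasDesign-byComputation tietze 73  (orbits 73 73 73 base₇₃) refl refl
  , hasDesign-byComputation tietze 100 (orbits 25 100 25 base₁₀₀) refl refl
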